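{- Let $g\colon\mathbb{N}\to\mathbb{N}$ be any non-decreasing unbounded function. Then $\phi_g$ is a bijection from $\mathbb{N}^2$ to $\mathbb{N}$ (a pairing function), and $\psi_g$ is its inverse.
   Context: $\mathbb{N}$ denotes the non-negative integers. $g$ is non-decreasing if $x\le y$ implies $g(x)\le g(y)$, and unbounded if for every $y\in\mathbb{N}$ there is $x$ with $g(x)\ge y$. For unbounded $g$, define $g^+\colon\mathbb{N}\to\mathbb{N}$ by letting $g^+(y)$ be the smallest $x\in\mathbb{N}$ with $g(x)\ge y$. The step points of $g$ are the elements of the range of $g^+$, listed increasingly as $s_0<s_1<s_2<\cdots$ (there are infinitely many, and $s_0=0$). For each $k\in\mathbb{N}$ let $B_k=\{0,1,\ldots,s_{k+1}(g(s_k)+1)-1\}$. Define $\phi_g\colon\mathbb{N}^2\to\mathbb{N}$ by $\phi_g(x,y)=y\cdot g^+(y)+x$ if $y>g(x)$, and $\phi_g(x,y)=x(g(x)+1)+y$ otherwise. Define $\psi_g\colon\mathbb{N}\to\mathbb{N}^2$ as follows: for $z\in\mathbb{N}$, let $m$ be the smallest non-negative integer with $z\in B_m$; then $\psi_g(z)=\bigl(z\bmod s_m,\ \lfloor z/s_m\rfloor\bigr)$ if $z<s_m(g(s_m)+1)$, and $\psi_g(z)=\bigl(\lfloor z/(g(s_m)+1)\rfloor,\ z\bmod (g(s_m)+1)\bigr)$ otherwise. -}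

module Defs where

open import Data.Nat using (ℕ; zero; suc; _+_; _*_; _∸_; _≤_; _<_; _≤ᵇ_; _<ᵇ_; _≡ᵇ_)
open import Data.Nat.DivMod using (_/_; _%_)
open import Data.Bool using (Bool; true; false; if_then_else_; _∨_)
open import Data.Product using (Σ; ∃; _×_; _,_; proj₁)
open import Relation.Binary.PropositionalEquality using (_≡_)

NonDecreasing : (ℕ → ℕ) → Set
NonDecreasing g = ∀ {x y} → x ≤ y → g x ≤ g y

Unbounded : (ℕ → ℕ) → Set
Unbounded g = ∀ y → ∃ λ x → y ≤ g x

-- first i in [k, k + fuel) with p i = true; returns k + fuel if none.
find : (ℕ → Bool) → ℕ → ℕ → ℕ
find p k zero = k
find p k (suc f) = if p k then k else find p (suc k) f

-- least i ≥ start with p i, given a bound b ≥ start with p b true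
leastFrom : (ℕ → Bool) → (start b : ℕ) → ℕ
leastFrom p start b = find p start (b ∸ start)

module _ (g : ℕ → ℕ) (unb : Unbounded g) where

  -- g⁺ y = smallest x with g x ≥ y  (searched below the witness of unboundedness)
  gplus : ℕ → ℕ
  gplus y = leastFrom (λ x → y ≤ᵇ g x) 0 (proj₁ (unb y))

  anyUpTo : ℕ → ℕ → Bool
  anyUpTo x zero = gplus zero ≡ᵇ x
  anyUpTo x (suc n) = (gplus (suc n) ≡ᵇ x) ∨ anyUpTo x n

  -- x is in the range of g⁺  (any y with g⁺ y = x satisfies y ≤ g (g⁺ y) = g x)
  inRange : ℕ → Bool
  inRange x = anyUpTo x (g x)

  -- step points s₀ < s₁ < … : increasing enumeration of the range of g⁺.
  -- s (k+1) is the least element of the range that is > s k; the search is bounded by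
  -- g⁺ (g (s k) + 1), which lies in the range and exceeds s k.
  step : ℕ → ℕ
  step zero = leastFrom inRange 0 (gplus 0)
  step (suc k) = leastFrom inRange (suc (step k)) (gplus (suc (g (step k))))

  inB : ℕ → ℕ → Bool
  inB z k = z <ᵇ step (suc k) * suc (g (step k))

  phi : ℕ × ℕ → ℕ
  phi (x , y) = if g x <ᵇ y then y * gplus y + x else x * suc (g x) + y

  -- division / remainder; the divisor-zero case is never used by ψ_g
  mod' : ℕ → ℕ → ℕ
  mod' z zero = z
  mod' z (suc n) = z % suc n

  div' : ℕ → ℕ → ℕ
  div' z zero = z
  div' z (suc n) = z / suc n

  -- ψ_g ; the smallest m with z ∈ B_m satisfies m ≤ z, so searching [0, z] suffices
  psi : ℕ → ℕ × ℕ
  psi z =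
    let m  = leastFrom (inB z) 0 z
        sm = step m
    in if z <ᵇ sm * suc (g sm)
       then (mod' z sm , div' z sm)
       else (z / suc (g sm) , z % suc (g sm))

module Submission where

-- Write s_k for the step points of g and c_k = g(s_k).  We first show s₀ = 0 and
-- s_{k+1} = g⁺(c_k + 1); hence (s_k) and (c_k) are strictly increasing and g is constant,
-- equal to c_k, on [s_k, s_{k+1}).  The plane is then cut into
--   horizontal pieces H_k = {(x,y) | s_k ≤ x < s_{k+1}, y ≤ c_k},  where φ(x,y) = y + x(c_k+1),
--   vertical pieces   V_j = {(x,y) | x < s_{j+1}, c_j < y ≤ c_{j+1}}, where φ(x,y) = x + y s_{j+1},
-- and every pair lies in one of them.  φ maps H_k into [s_k(c_k+1), |B_k|) and V_j into
-- [|B_j|, s_{j+1}(c_{j+1}+1)), where |B_k| = s_{k+1}(c_k+1); this pins down the index of the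
-- first block containing φ(x,y), so ψ reads back exactly the remainder and quotient that φ
-- produced: ψ ∘ φ = id.  Conversely these intervals cover ℕ, so φ is onto, and φ ∘ ψ = id
-- follows from ψ ∘ φ = id.

open import Defs
open import Data.Nat using (ℕ; zero; suc; _+_; _*_; _∸_; _≤_; _<_; _≤ᵇ_; z≤n; s≤s; NonZero)
open import Data.Nat.Properties
open import Data.Nat.DivMod using (_/_; _%_; m≡m%n+[m/n]*n; m%n<n; [m+kn]%n≡m%n; m<n⇒m%n≡m)
open import Data.Bool using (Bool; true; false; T; if_then_else_)
open import Data.Bool.Properties using (T-∨)
open import Data.Product using (∃-syntax; _×_; _,_; proj₁; proj₂)
open import Data.Sum using (_⊎_; inj₁; inj₂)
open import Data.Empty using (⊥; ⊥-elim)
open import Data.Unit using (tt)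
open import Function using (_∘_)
open import Function.Bundles using (Equivalence)
open import Relation.Nullary using (¬_; yes; no)
open import Relation.Binary.Definitions using (tri<; tri≈; tri>)
open import Relation.Binary.PropositionalEquality
  using (_≡_; refl; sym; trans; cong; cong₂; subst; module ≡-Reasoning)

if-T : ∀ {A : Set} {b} {x y : A} → T b → (if b then x else y) ≡ x
if-T {b = true} _ = refl

if-¬T : ∀ {A : Set} {b} {x y : A} → ¬ T b → (if b then x else y) ≡ y
if-¬T {b = false} _ = refl
if-¬T {b = true} ¬b = ⊥-elim (¬b tt)

record IsLeastFrom (p : ℕ → Bool) (a r : ℕ) : Set where
  field
    from  : a ≤ r
    holds : T (p r)
    least : ∀ i → a ≤ i → i < r → ¬ T (p i)
open IsLeastFrom

least-unique : ∀ {p a r r′} → IsLeastFrom p a r → IsLeastFrom p a r′ → r ≡ r′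
least-unique {r = r} {r′} h h′ with <-cmp r r′
... | tri< r<r′ _ _ = ⊥-elim (least h′ r (from h) r<r′ (holds h))
... | tri≈ _ r≡r′ _ = r≡r′
... | tri> _ _ r′<r = ⊥-elim (least h r′ (from h′) r′<r (holds h′))

find-least : ∀ p a n → T (p (a + n)) → IsLeastFrom p a (find p a n)
find-least p a zero p[a+0] = record
  { from = ≤-refl ; holds = subst (T ∘ p) (+-identityʳ a) p[a+0]
  ; least = λ i a≤i i<a → ⊥-elim (<⇒≱ i<a a≤i) }
find-least p a (suc n) p[a+n+1] with p a in pa
... | true = record
  { from = ≤-refl ; holds = subst T (sym pa) tt
  ; least = λ i a≤i i<a → ⊥-elim (<⇒≱ i<a a≤i) }
... | false = record { from = ≤-trans (n≤1+n a) (from later) ; holds = holds later ; least = below }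
  where
  later : IsLeastFrom p (suc a) (find p (suc a) n)
  later = find-least p (suc a) n (subst (T ∘ p) (+-suc a n) p[a+n+1])
  below : ∀ i → a ≤ i → i < find p (suc a) n → ¬ T (p i)
  below i a≤i i<r with m≤n⇒m<n∨m≡n a≤i
  ... | inj₁ a<i = least later i a<i i<r
  ... | inj₂ refl = subst T pa

leastFrom-least : ∀ p {a b} → a ≤ b → T (p b) → IsLeastFrom p a (leastFrom p a b)
leastFrom-least p {a} {b} a≤b pb =
  find-least p a (b ∸ a) (subst (T ∘ p) (sym (m+[n∸m]≡n a≤b)) pb)

leastFrom-≡ : ∀ p {a b r} → a ≤ b → T (p b) → IsLeastFrom p a r → leastFrom p a b ≡ r
leastFrom-≡ p a≤b pb = least-unique (leastFrom-least p a≤b pb)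

StrictlyIncreasing : (ℕ → ℕ) → Set
StrictlyIncreasing f = ∀ k → f k < f (suc k)

module _ {f : ℕ → ℕ} (inc : StrictlyIncreasing f) where

  incr-mono : ∀ {m n} → m ≤ n → f m ≤ f n
  incr-mono {m} {n} m≤n with m≤n⇒m<n∨m≡n m≤n
  ... | inj₂ refl = ≤-refl
  incr-mono {m} {suc n} _ | inj₁ (s≤s m≤n) = ≤-trans (incr-mono m≤n) (<⇒≤ (inc n))

  incr-≥ : ∀ n → n ≤ f n
  incr-≥ zero = z≤n
  incr-≥ (suc n) = ≤-<-trans (incr-≥ n) (inc n)

  -- Every x ≥ f 0 lies in an interval [f k, f (k+1)); search down from f (x+1) > x.
  locate : ∀ {x} → f 0 ≤ x → ∃[ k ] f k ≤ x × x < f (suc k)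
  locate {x} f0≤x = search (suc x) (incr-≥ (suc x))
    where
    search : ∀ n → x < f n → ∃[ k ] f k ≤ x × x < f (suc k)
    search zero x<f0 = ⊥-elim (<⇒≱ x<f0 f0≤x)
    search (suc n) x<fn+1 with x <? f n
    ... | yes x<fn = search n x<fn
    ... | no x≮fn = n , ≮⇒≥ x≮fn , x<fn+1

divmod-unique : ∀ {r n} q .{{_ : NonZero n}} → r < n →
  (r + q * n) % n ≡ r × (r + q * n) / n ≡ q
divmod-unique {r} {n} q r<n = remainder , sym (*-cancelʳ-≡ q _ n (+-cancelˡ-≡ r _ _ decomposition))
  where
  z : ℕ
  z = r + q * n
  remainder : z % n ≡ r
  remainder = trans ([m+kn]%n≡m%n r q n) (m<n⇒m%n≡m r<n)
  decomposition : r + q * n ≡ r + (z / n) * n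
  decomposition = trans (m≡m%n+[m/n]*n z n) (cong (λ t → t + (z / n) * n) remainder)

quotient-between : ∀ {z r q n a b} → z ≡ r + q * n → r < n → a * n ≤ z → z < b * n → a ≤ q × q < b
quotient-between {z} {r} {q} {n} {a} {b} z≡ r<n an≤z z<bn =
  ≤-pred (*-cancelʳ-< n a (suc q) (≤-<-trans an≤z z<[q+1]n)) ,
  *-cancelʳ-< n q b (≤-<-trans qn≤z z<bn)
  where
  z<[q+1]n : z < suc q * n
  z<[q+1]n = subst (_< suc q * n) (sym z≡) (+-monoˡ-< (q * n) r<n)
  qn≤z : q * n ≤ z
  qn≤z = subst (q * n ≤_) (sym z≡) (m≤n+m (q * n) r)

module Pairing (g : ℕ → ℕ) (mono : NonDecreasing g) (unb : Unbounded g) where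

  g⁺ : ℕ → ℕ
  g⁺ = gplus g unb

  s : ℕ → ℕ
  s = step g unb

  c : ℕ → ℕ
  c k = g (s k)

  g⁺-least : ∀ y → IsLeastFrom (λ x → y ≤ᵇ g x) 0 (g⁺ y)
  g⁺-least y = leastFrom-least _ z≤n (≤⇒≤ᵇ (proj₂ (unb y)))

  g⁺-reaches : ∀ y → y ≤ g (g⁺ y)
  g⁺-reaches y = ≤ᵇ⇒≤ _ _ (holds (g⁺-least y))

  g⁺-below : ∀ {x y} → x < g⁺ y → g x < y
  g⁺-below {x} {y} x<g⁺y = ≰⇒> (λ y≤gx → least (g⁺-least y) x z≤n x<g⁺y (≤⇒≤ᵇ y≤gx))

  -- Hence g⁺ is the lower adjoint of g: g⁺ y ≤ x iff y ≤ g x.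
  g⁺-min : ∀ {x y} → y ≤ g x → g⁺ y ≤ x
  g⁺-min y≤gx = ≮⇒≥ (λ x<g⁺y → <⇒≱ (g⁺-below x<g⁺y) y≤gx)

  anyUpTo-sound : ∀ {x} n → T (anyUpTo g unb x n) → ∃[ y ] y ≤ n × g⁺ y ≡ x
  anyUpTo-sound zero hit = 0 , z≤n , ≡ᵇ⇒≡ _ _ hit
  anyUpTo-sound (suc n) hit with Equivalence.to T-∨ hit
  ... | inj₁ here = suc n , ≤-refl , ≡ᵇ⇒≡ _ _ here
  ... | inj₂ earlier with anyUpTo-sound n earlier
  ...   | y , y≤n , g⁺y≡x = y , m≤n⇒m≤1+n y≤n , g⁺y≡x

  anyUpTo-complete : ∀ {x y} n → y ≤ n → g⁺ y ≡ x → T (anyUpTo g unb x n)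
  anyUpTo-complete zero z≤n g⁺y≡x = ≡⇒≡ᵇ _ _ g⁺y≡x
  anyUpTo-complete (suc n) y≤n+1 g⁺y≡x with m≤n⇒m<n∨m≡n y≤n+1
  ... | inj₂ refl = Equivalence.from T-∨ (inj₁ (≡⇒≡ᵇ _ _ g⁺y≡x))
  ... | inj₁ (s≤s y≤n) = Equivalence.from T-∨ (inj₂ (anyUpTo-complete n y≤n g⁺y≡x))

  -- s₀ = 0: since g⁺ 0 = 0 the search for the first step point has an empty range.
  s-zero : s 0 ≡ 0
  s-zero = cong (λ b → find (inRange g unb) 0 (b ∸ 0)) (n≤0⇒n≡0 (g⁺-min z≤n))

  s-zero≤ : ∀ x → s 0 ≤ x
  s-zero≤ x = subst (_≤ x) (sym s-zero) z≤n

  -- g⁺(c_k + 1) > s_k, because g (g⁺(c_k + 1)) > c_k = g(s_k) and g is non-decreasing.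
  s-below-next : ∀ k → s k < g⁺ (suc (c k))
  s-below-next k = ≰⇒> (λ next≤sk → <⇒≱ (s≤s (mono next≤sk)) (g⁺-reaches (suc (c k))))

  -- s_{k+1} = g⁺(c_k + 1): this lies in the range of g⁺, beyond s_k, and any y with
  -- s_k < g⁺ y < g⁺(c_k + 1) would satisfy y ≤ c_k, forcing g⁺ y ≤ s_k.
  s-suc : ∀ k → s (suc k) ≡ g⁺ (suc (c k))
  s-suc k = leastFrom-≡ (inRange g unb) (s-below-next k) in-range record
    { from = s-below-next k ; holds = in-range ; least = nothing-between }
    where
    in-range : T (inRange g unb (g⁺ (suc (c k))))
    in-range = anyUpTo-complete _ (g⁺-reaches _) refl
    nothing-between : ∀ i → suc (s k) ≤ i → i < g⁺ (suc (c k)) → ¬ T (inRange g unb i)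
    nothing-between i sk<i i<next hit with anyUpTo-sound (g i) hit
    ... | y , y≤gi , g⁺y≡i =
      <⇒≱ sk<i (subst (_≤ s k) g⁺y≡i (g⁺-min (≤-trans y≤gi (≤-pred (g⁺-below i<next)))))

  s-inc : StrictlyIncreasing s
  s-inc k = subst (s k <_) (sym (s-suc k)) (s-below-next k)

  c-inc : StrictlyIncreasing c
  c-inc k = subst (λ t → c k < g t) (sym (s-suc k)) (g⁺-reaches (suc (c k)))

  s-pos : ∀ j → 0 < s (suc j)
  s-pos j = ≤-<-trans z≤n (s-inc j)

  c-const : ∀ {k x} → s k ≤ x → x < s (suc k) → g x ≡ c k
  c-const {k} sk≤x x<sk+1 =
    ≤-antisym (≤-pred (g⁺-below (subst (_ <_) (s-suc k) x<sk+1))) (mono sk≤x)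

  g⁺-step : ∀ {j y} → c j < y → y ≤ c (suc j) → g⁺ y ≡ s (suc j)
  g⁺-step {j} {y} cj<y y≤cj+1 = ≤-antisym (g⁺-min y≤cj+1) (≮⇒≥ too-small)
    where
    too-small : g⁺ y < s (suc j) → ⊥
    too-small lt = <⇒≱ cj<y
      (≤-trans (g⁺-reaches y) (≤-pred (g⁺-below (subst (g⁺ y <_) (s-suc j) lt))))

  record Horizontal (k x y : ℕ) : Set where
    constructor horizontal
    field
      on-step : s k ≤ x
      before-next : x < s (suc k)
      under : y ≤ c k

  record Vertical (j x y : ℕ) : Set where
    constructor vertical
    field
      before-next : x < s (suc j)
      above : c j < y
      under : y ≤ c (suc j)

  -- Every pair lies in a piece: locate y among the c_j if y > g x, else x among the s_k.
  classify : ∀ x y → (∃[ j ] Vertical j x y) ⊎ (∃[ k ] Horizontal k x y)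
  classify x y with g x <? y
  classify x zero | yes ()
  classify x (suc y) | yes (s≤s gx≤y) with locate c-inc (≤-trans (mono (s-zero≤ x)) gx≤y)
  ... | j , cj≤y , y<cj+1 = inj₁ (j , vertical x<sj+1 (s≤s cj≤y) y<cj+1)
    where
    x<sj+1 : x < s (suc j)
    x<sj+1 = ≰⇒> (λ sj+1≤x → <⇒≱ y<cj+1 (≤-trans (mono sj+1≤x) gx≤y))
  classify x y | no gx≮y with locate s-inc (s-zero≤ x)
  ... | k , sk≤x , x<sk+1 =
    inj₂ (k , horizontal sk≤x x<sk+1 (subst (y ≤_) (c-const {k} sk≤x x<sk+1) (≮⇒≥ gx≮y)))

  -- On H_k we have y ≤ g x = c_k, so φ takes its second branch.
  φ-horizontal : ∀ {k x y} → Horizontal k x y → phi g unb (x , y) ≡ y + x * suc (c k)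
  φ-horizontal {k} {x} {y} (horizontal sk≤x x<sk+1 y≤ck) = begin
    phi g unb (x , y)   ≡⟨ if-¬T (λ gx<y → <⇒≱ (<ᵇ⇒< _ _ gx<y) y≤gx) ⟩
    x * suc (g x) + y   ≡⟨ cong (λ t → x * suc t + y) gx≡ck ⟩
    x * suc (c k) + y   ≡⟨ +-comm _ y ⟩
    y + x * suc (c k)   ∎
    where
    open ≡-Reasoning
    gx≡ck : g x ≡ c k
    gx≡ck = c-const {k} sk≤x x<sk+1
    y≤gx : y ≤ g x
    y≤gx = subst (y ≤_) (sym gx≡ck) y≤ck

  -- On V_j we have g x ≤ c_j < y and g⁺ y = s_{j+1}, so φ takes its first branch.
  φ-vertical : ∀ {j x y} → Vertical j x y → phi g unb (x , y) ≡ x + y * s (suc j)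
  φ-vertical {j} {x} {y} (vertical x<sj+1 cj<y y≤cj+1) = begin
    phi g unb (x , y)   ≡⟨ if-T (<⇒<ᵇ gx<y) ⟩
    y * g⁺ y + x        ≡⟨ cong (λ t → y * t + x) (g⁺-step {j} cj<y y≤cj+1) ⟩
    y * s (suc j) + x   ≡⟨ +-comm _ x ⟩
    x + y * s (suc j)   ∎
    where
    open ≡-Reasoning
    gx<y : g x < y
    gx<y = ≤-<-trans (≤-pred (g⁺-below (subst (x <_) (s-suc j) x<sj+1))) cj<y

  blockEnd : ℕ → ℕ
  blockEnd m = s (suc m) * suc (c m)

  blockIndex : ℕ → ℕ
  blockIndex z = leastFrom (inB g unb z) 0 z

  blockEnd-inc : StrictlyIncreasing blockEnd
  blockEnd-inc m = *-mono-< (s-inc (suc m)) (s≤s (c-inc m))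

  blockIndex-≡ : ∀ {z m} → z < blockEnd m → (∀ i → i < m → blockEnd i ≤ z) → blockIndex z ≡ m
  blockIndex-≡ {z} z<end earlier =
    leastFrom-≡ (inB g unb z) {b = z} z≤n (<⇒<ᵇ z<blockEnd-z) record
    { from = z≤n ; holds = <⇒<ᵇ z<end
    ; least = λ i _ i<m z<endᵢ → <⇒≱ (<ᵇ⇒< _ _ z<endᵢ) (earlier i i<m) }
    where
    z<blockEnd-z : z < blockEnd z
    z<blockEnd-z = <-≤-trans (incr-≥ s-inc (suc z)) (m≤m*n (s (suc z)) (suc (c z)))

  ψ-lower : ∀ {z m} → blockIndex z ≡ m → z < s m * suc (c m) →
    psi g unb z ≡ (mod' g unb z (s m) , div' g unb z (s m))
  ψ-lower refl below = if-T (<⇒<ᵇ below)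

  ψ-upper : ∀ {z m} → blockIndex z ≡ m → s m * suc (c m) ≤ z →
    psi g unb z ≡ (z / suc (c m) , z % suc (c m))
  ψ-upper refl above = if-¬T (λ below → <⇒≱ (<ᵇ⇒< _ _ below) above)

  divmod′-decompose : ∀ z {n} → 0 < n →
    z ≡ mod' g unb z n + div' g unb z n * n × mod' g unb z n < n
  divmod′-decompose z {suc n} _ = m≡m%n+[m/n]*n z (suc n) , m%n<n z (suc n)

  divmod′-unique : ∀ {r n} q → r < n →
    (mod' g unb (r + q * n) n , div' g unb (r + q * n) n) ≡ (r , q)
  divmod′-unique {r} {suc n} q r<n = cong₂ _,_ (proj₁ unique) (proj₂ unique)
    where
    unique : (r + q * suc n) % suc n ≡ r × (r + q * suc n) / suc n ≡ q
    unique = divmod-unique q r<n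

  -- φ maps H_k into [s_k(c_k+1), |B_k|), where ψ undoes it.
  ψ-horizontal : ∀ {k x y} → Horizontal k x y → psi g unb (y + x * suc (c k)) ≡ (x , y)
  ψ-horizontal {k} {x} {y} (horizontal sk≤x x<sk+1 y≤ck) = begin
    psi g unb z       ≡⟨ ψ-upper {z} (blockIndex-≡ {z} z<end earlier) corner≤z ⟩
    (z / N , z % N)   ≡⟨ cong₂ _,_ (proj₂ unique) (proj₁ unique) ⟩
    (x , y)           ∎
    where
    open ≡-Reasoning
    N : ℕ
    N = suc (c k)
    z : ℕ
    z = y + x * N
    unique : z % N ≡ y × z / N ≡ x
    unique = divmod-unique x (s≤s y≤ck)
    corner≤z : s k * N ≤ z
    corner≤z = ≤-trans (*-monoˡ-≤ N sk≤x) (m≤n+m (x * N) y)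
    z<end : z < blockEnd k
    z<end = <-≤-trans (+-monoˡ-< (x * N) (s≤s y≤ck)) (*-monoˡ-≤ N x<sk+1)
    earlier : ∀ i → i < k → blockEnd i ≤ z
    earlier i i<k =
      ≤-trans (*-mono-≤ (incr-mono s-inc i<k) (s≤s (incr-mono c-inc (<⇒≤ i<k)))) corner≤z

  -- φ maps V_j into [|B_j|, s_{j+1}(c_{j+1}+1)), where ψ undoes it.
  ψ-vertical : ∀ {j x y} → Vertical j x y → psi g unb (x + y * s (suc j)) ≡ (x , y)
  ψ-vertical {j} {x} {y} (vertical x<S cj<y y≤cj+1) = begin
    psi g unb z                         ≡⟨ ψ-lower {z} (blockIndex-≡ {z} z<end earlier) z<corner ⟩
    (mod' g unb z S , div' g unb z S)   ≡⟨ divmod′-unique y x<S ⟩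
    (x , y)                             ∎
    where
    open ≡-Reasoning
    S : ℕ
    S = s (suc j)
    z : ℕ
    z = x + y * S
    z<corner : z < S * suc (c (suc j))
    z<corner = <-≤-trans (+-monoˡ-< (y * S) x<S)
      (≤-trans (*-monoˡ-≤ S (s≤s y≤cj+1)) (≤-reflexive (*-comm (suc (c (suc j))) S)))
    z<end : z < blockEnd (suc j)
    z<end = <-≤-trans z<corner (*-monoˡ-≤ _ (<⇒≤ (s-inc (suc j))))
    earlier : ∀ i → i < suc j → blockEnd i ≤ z
    earlier i (s≤s i≤j) = ≤-trans (incr-mono blockEnd-inc i≤j)
      (≤-trans (≤-reflexive (*-comm S _)) (≤-trans (*-monoˡ-≤ S cj<y) (m≤n+m (y * S) x)))

  horizontal-from : ∀ {k z} → s k * suc (c k) ≤ z → z < blockEnd k →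
    Horizontal k (z / suc (c k)) (z % suc (c k))
  horizontal-from {k} {z} corner≤z z<end =
    horizontal (proj₁ x-bounds) (proj₂ x-bounds) (≤-pred (m%n<n z N))
    where
    N : ℕ
    N = suc (c k)
    x-bounds : s k ≤ z / N × z / N < s (suc k)
    x-bounds = quotient-between (m≡m%n+[m/n]*n z N) (m%n<n z N) corner≤z z<end

  vertical-from : ∀ {j z} → blockEnd j ≤ z → z < s (suc j) * suc (c (suc j)) →
    Vertical j (mod' g unb z (s (suc j))) (div' g unb z (s (suc j)))
  vertical-from {j} {z} end≤z z<corner =
    vertical (proj₂ decomposition) (proj₁ y-bounds) (≤-pred (proj₂ y-bounds))
    where
    S : ℕ
    S = s (suc j)
    decomposition : z ≡ mod' g unb z S + div' g unb z S * S × mod' g unb z S < S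
    decomposition = divmod′-decompose z (s-pos j)
    y-bounds : suc (c j) ≤ div' g unb z S × div' g unb z S < suc (c (suc j))
    y-bounds = quotient-between (proj₁ decomposition) (proj₂ decomposition)
      (subst (_≤ z) (*-comm S _) end≤z) (subst (z <_) (*-comm S _) z<corner)

  -- φ is onto: z lies below |B_0|, or between |B_j| and |B_{j+1}|, on either side of the corner.
  φ-onto : ∀ z → ∃[ p ] phi g unb p ≡ z
  φ-onto z with z <? blockEnd 0
  ... | yes z<end₀ = (z / N₀ , z % N₀) ,
    trans (φ-horizontal (horizontal-from {0} corner≤z z<end₀)) (sym (m≡m%n+[m/n]*n z N₀))
    where
    N₀ : ℕ
    N₀ = suc (c 0)
    corner≤z : s 0 * N₀ ≤ z
    corner≤z = subst (λ t → t * N₀ ≤ z) (sym s-zero) z≤n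
  ... | no z≮end₀ with locate blockEnd-inc (≮⇒≥ z≮end₀)
  ...   | j , endⱼ≤z , z<endⱼ₊₁ with z <? s (suc j) * suc (c (suc j))
  ...     | yes z<corner = (mod' g unb z (s (suc j)) , div' g unb z (s (suc j))) ,
    trans (φ-vertical (vertical-from {j} endⱼ≤z z<corner))
          (sym (proj₁ (divmod′-decompose z (s-pos j))))
  ...     | no z≮corner = (z / N , z % N) ,
    trans (φ-horizontal (horizontal-from {suc j} (≮⇒≥ z≮corner) z<endⱼ₊₁))
          (sym (m≡m%n+[m/n]*n z N))
    where
    N : ℕ
    N = suc (c (suc j))

  ψ∘φ : ∀ p → psi g unb (phi g unb p) ≡ p
  ψ∘φ (x , y) with classify x y
  ... | inj₁ (j , v) = trans (cong (psi g unb) (φ-vertical v)) (ψ-vertical v)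
  ... | inj₂ (k , h) = trans (cong (psi g unb) (φ-horizontal h)) (ψ-horizontal h)

  -- Writing z = φ p, we get φ (ψ z) = φ (ψ (φ p)) = φ p = z.
  φ∘ψ : ∀ z → phi g unb (psi g unb z) ≡ z
  φ∘ψ z with φ-onto z
  ... | p , refl = cong (phi g unb) (ψ∘φ p)

theorem4p7 : (g : ℕ → ℕ) → NonDecreasing g → (unb : Unbounded g) →
    ((p : ℕ × ℕ) → psi g unb (phi g unb p) ≡ p) ×
    ((z : ℕ) → phi g unb (psi g unb z) ≡ z)
theorem4p7 g mono unb = ψ∘φ , φ∘ψ
  where open Pairing g mono unb
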